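{- For every nested sequent $\Gamma$ and every Kripke model $\mathcal{M}$, $\mathcal{M}\models\Gamma$ if and only if $\mathcal{M}\models\iota(\Gamma)$.
   Context: Formulas are modal formulas in negation normal form (built from $\bot,\top$, atoms $p$ and negated atoms $\overline p$ with $\wedge,\vee,\Box,\Diamond$). A nested sequent is defined recursively: $\varphi_1,\dots,\varphi_n,[\Gamma_1],\dots,[\Gamma_m]$ (a multiset, $n,m\ge0$) with formulas $\varphi_i$ and nested sequents $\Gamma_j$. Its formula interpretation is $\iota(\varphi_1,\dots,\varphi_n,[\Gamma_1],\dots,[\Gamma_m])=\varphi_1\vee\dots\vee\varphi_n\vee\Box\iota(\Gamma_1)\vee\dots\vee\Box\iota(\Gamma_m)$ (empty disjunction is $\bot$). Nodes of a nested sequent carry labels: the top level has label $1$, and if the node with label $\sigma$ is $\varphi_1,\dots,\varphi_n,[\Gamma_1],\dots,[\Gamma_m]$ then $\Gamma_j$ has label $\sigma\ast j$; $\mathcal{L}(\Gamma)$ is the set of labels, and $\sigma:\varphi\in\Gamma$ means $\varphi$ occurs in node $\sigma$ outside further brackets. For a Kripke model $\mathcal{M}=(W,R,V)$, a multiworld interpretation of $\Gamma$ into $\mathcal{M}$ is $\mathcal{I}:\mathcal{L}(\Gamma)\to W$ with $\mathcal{I}(\sigma)R\mathcal{I}(\sigma\ast n)$ whenever $\sigma,\sigma\ast n\in\mathcal{L}(\Gamma)$; $\mathcal{M},\mathcal{I}\models\Gamma$ iff $\mathcal{M},\mathcal{I}(\sigma)\models\varphi$ for some $\sigma:\varphi\in\Gamma$;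 $\mathcal{M}\models\Gamma$ iff $\mathcal{M},\mathcal{I}\models\Gamma$ for all multiworld interpretations $\mathcal{I}$ of $\Gamma$ into $\mathcal{M}$. For a formula, $\mathcal{M}\models\varphi$ means $\varphi$ is true at every world of $\mathcal{M}$. -}

module Defs where

open import Data.Nat using (ℕ; zero; suc)
open import Data.List using (List; []; _∷_; map; _++_; [_])
open import Data.List.Membership.Propositional using (_∈_)
open import Data.Product using (Σ; ∃; _×_; _,_)
open import Data.Sum using (_⊎_)
open import Data.Empty using (⊥)
open import Data.Unit using (⊤)
open import Relation.Nullary using (¬_)

Atom : Set
Atom = ℕ

data Fm : Set where
  ⊥ᶠ ⊤ᶠ : Fm
  pos neg : Atom → Fm
  _∧ᶠ_ _∨ᶠ_ : Fm → Fm → Fm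
  □ᶠ ◇ᶠ : Fm → Fm

-- Nested sequents  φ₁,…,φₙ,[Γ₁],…,[Γₘ]  (multisets represented by lists).
data NSeq : Set where
  _▸_ : List Fm → List NSeq → NSeq

⋁ : List Fm → Fm
⋁ []           = ⊥ᶠ
⋁ (φ ∷ [])     = φ
⋁ (φ ∷ ψ ∷ φs) = φ ∨ᶠ ⋁ (ψ ∷ φs)

mutual
  ι : NSeq → Fm
  ι (φs ▸ Δs) = ⋁ (φs ++ boxes Δs)

  boxes : List NSeq → List Fm
  boxes []       = []
  boxes (Δ ∷ Δs) = □ᶠ (ι Δ) ∷ boxes Δs

-- 1-based position in a list:  Nth xs j x  means the j-th element of xs is x.
data Nth {A : Set} : List A → ℕ → A → Set where
  nth-here  : ∀ {x xs} → Nth (x ∷ xs) 1 x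
  nth-there : ∀ {x y xs j} → Nth xs j x → Nth (y ∷ xs) (suc j) x

-- Labels: the label 1∗j₁∗⋯∗jₖ is represented by the list [j₁,…,jₖ];
-- the root label 1 is [].
Label : Set
Label = List ℕ

root : Label
root = []

_∗_ : Label → ℕ → Label
σ ∗ n = σ ++ [ n ]

data _∈L_ : Label → NSeq → Set where
  lroot  : ∀ {Γ} → [] ∈L Γ
  lchild : ∀ {φs Δs j Δ σ} → Nth Δs j Δ → σ ∈L Δ → (j ∷ σ) ∈L (φs ▸ Δs)

data _∶_∈N_ : Label → Fm → NSeq → Set where
  nhere  : ∀ {φ φs Δs} → φ ∈ φs → [] ∶ φ ∈N (φs ▸ Δs)
  nthere : ∀ {φ φs Δs j Δ σ} → Nth Δs j Δ → σ ∶ φ ∈N Δ → (j ∷ σ) ∶ φ ∈N (φs ▸ Δs)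

record Model : Set₁ where
  field
    W : Set
    R : W → W → Set
    V : Atom → W → Set
open Model public

_,_⊩_ : (M : Model) → W M → Fm → Set
M , w ⊩ ⊥ᶠ      = ⊥
M , w ⊩ ⊤ᶠ      = ⊤
M , w ⊩ pos p   = V M p w
M , w ⊩ neg p   = ¬ V M p w
M , w ⊩ (φ ∧ᶠ ψ) = (M , w ⊩ φ) × (M , w ⊩ ψ)
M , w ⊩ (φ ∨ᶠ ψ) = (M , w ⊩ φ) ⊎ (M , w ⊩ ψ)
M , w ⊩ □ᶠ φ    = ∀ v → R M w v → M , v ⊩ φ
M , w ⊩ ◇ᶠ φ    = Σ (W M) λ v → R M w v × (M , v ⊩ φ)

_⊨ᶠ_ : Model → Fm → Set
M ⊨ᶠ φ = ∀ w → M , w ⊩ φ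

-- Multiworld interpretations of Γ into M.  The map is given on all labels,
-- but only its values on 𝓛(Γ) are constrained or used.
IsMultiworld : (M : Model) (Γ : NSeq) → (Label → W M) → Set
IsMultiworld M Γ I = ∀ σ n → σ ∈L Γ → (σ ∗ n) ∈L Γ → R M (I σ) (I (σ ∗ n))

_,_⊨ᴵ_ : (M : Model) → (Label → W M) → NSeq → Set
M , I ⊨ᴵ Γ = Σ Label λ σ → Σ Fm λ φ → (σ ∶ φ ∈N Γ) × (M , I σ ⊩ φ)

_⊨ˢ_ : Model → NSeq → Set
M ⊨ˢ Γ = (I : Label → W M) → IsMultiworld M Γ I → M , I ⊨ᴵ Γ

{-# OPTIONS --safe #-}
-- Soundness (M ⊨ ι Γ ⇒ M ⊨ Γ): by induction on Γ, a disjunct of ι Γ true at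
-- the root world either is a formula of the root node or a box □ ι Δ, which
-- holds at the successor world assigned to the child Δ, so the induction
-- hypothesis applies to the restricted interpretation.
-- Completeness (M ⊨ Γ ⇒ M ⊨ ι Γ): if ι Γ fails at w, classically every box
-- □ ι Δ of the root fails at some successor of w, where ι Δ fails; grafting
-- the countermodels of the children onto w gives a multiworld interpretation
-- falsifying every formula of Γ.
module Submission where

open import Level using (0ℓ)
open import Axiom.ExcludedMiddle using (ExcludedMiddle)
open import Axiom.DoubleNegationElimination using (em⇒dne)
open import Function.Bundles using (_⇔_; mk⇔)
open import Defs
open import Data.Nat using (ℕ; zero; suc)
open import Data.List using (List; []; _∷_; _++_)
open import Data.List.Relation.Unary.Any using (Any; here; there)
open import Data.List.Relation.Unary.Any.Properties using (++⁺ˡ; ++⁺ʳ; ++⁻)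
open import Data.List.Membership.Propositional using (_∈_; find; lose)
open import Data.Product using (Σ; _×_; _,_)
open import Data.Sum using (_⊎_; inj₁; inj₂)
open import Relation.Nullary using (¬_)
open import Relation.Binary.PropositionalEquality using (_≡_; refl)

module _ (P : NSeq → Set)
         (step : ∀ φs Δs → (∀ {j Δ} → Nth Δs j Δ → P Δ) → P (φs ▸ Δs)) where
  mutual
    NSeq-ind : ∀ Γ → P Γ
    NSeq-ind (φs ▸ Δs) = step φs Δs (NSeq-indᴸ Δs)

    NSeq-indᴸ : ∀ Δs {j Δ} → Nth Δs j Δ → P Δ
    NSeq-indᴸ (Δ ∷ _)  nth-here      = NSeq-ind Δ
    NSeq-indᴸ (_ ∷ Δs) (nth-there n) = NSeq-indᴸ Δs n

Nth-functional : ∀ {A : Set} {xs : List A} {j x y} → Nth xs j x → Nth xs j y → x ≡ y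
Nth-functional nth-here      nth-here      = refl
Nth-functional (nth-there m) (nth-there n) = Nth-functional m n

-- The default b is the junk value at the positions 0 and beyond the list.
Nth-choice : ∀ {A B : Set} {P : A → B → Set} → B → ∀ xs →
             (∀ {j x} → Nth xs j x → Σ B (P x)) →
             Σ (ℕ → B) λ f → ∀ {j x} → Nth xs j x → P x (f j)
Nth-choice b []       choose = (λ _ → b) , λ ()
Nth-choice {P = P} b (x ∷ xs) choose
  with choose nth-here | Nth-choice b xs (λ n → choose (nth-there n))
... | y , py | g , pg = f , pf
  where
  f : ℕ → _
  f zero          = b
  f (suc zero)    = y
  f (suc (suc j)) = g (suc j)

  pf : ∀ {j x′} → Nth (x ∷ xs) j x′ → P x′ (f j)
  pf nth-here                  = py
  pf (nth-there {j = suc j} n) = pg n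

graft : {A : Set} → A → (ℕ → Label → A) → Label → A
graft w f []      = w
graft w f (j ∷ σ) = f j σ

module _ (M : Model) where

  ⋁⁺ : ∀ {w} xs → Any (M , w ⊩_) xs → M , w ⊩ ⋁ xs
  ⋁⁺ (φ ∷ [])     (here p)  = p
  ⋁⁺ (φ ∷ ψ ∷ xs) (here p)  = inj₁ p
  ⋁⁺ (φ ∷ ψ ∷ xs) (there p) = inj₂ (⋁⁺ (ψ ∷ xs) p)

  ⋁⁻ : ∀ {w} xs → M , w ⊩ ⋁ xs → Any (M , w ⊩_) xs
  ⋁⁻ (φ ∷ [])     p        = here p
  ⋁⁻ (φ ∷ ψ ∷ xs) (inj₁ p) = here p
  ⋁⁻ (φ ∷ ψ ∷ xs) (inj₂ p) = there (⋁⁻ (ψ ∷ xs) p)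

  boxes⁺ : ∀ {w} Δs {j Δ} → Nth Δs j Δ → M , w ⊩ □ᶠ (ι Δ) → Any (M , w ⊩_) (boxes Δs)
  boxes⁺ (Δ ∷ Δs) nth-here      p = here p
  boxes⁺ (_ ∷ Δs) (nth-there n) p = there (boxes⁺ Δs n p)

  boxes⁻ : ∀ {w} Δs → Any (M , w ⊩_) (boxes Δs) →
           Σ ℕ λ j → Σ NSeq λ Δ → Nth Δs j Δ × (M , w ⊩ □ᶠ (ι Δ))
  boxes⁻ (Δ ∷ Δs) (here p)  = 1 , Δ , nth-here , p
  boxes⁻ (Δ ∷ Δs) (there p) with boxes⁻ Δs p
  ... | j , Δ′ , n , q = suc j , Δ′ , nth-there n , q

  ι-formula⁺ : ∀ {w φ φs} Δs → φ ∈ φs → M , w ⊩ φ → M , w ⊩ ι (φs ▸ Δs)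
  ι-formula⁺ {φs = φs} Δs φ∈φs p = ⋁⁺ (φs ++ boxes Δs) (++⁺ˡ (lose φ∈φs p))

  ι-box⁺ : ∀ {w} φs {Δs j Δ} → Nth Δs j Δ → M , w ⊩ □ᶠ (ι Δ) → M , w ⊩ ι (φs ▸ Δs)
  ι-box⁺ φs {Δs} n p = ⋁⁺ (φs ++ boxes Δs) (++⁺ʳ φs (boxes⁺ Δs n p))

  ι⁻ : ∀ {w} φs Δs → M , w ⊩ ι (φs ▸ Δs) →
       Any (M , w ⊩_) φs ⊎ (Σ ℕ λ j → Σ NSeq λ Δ → Nth Δs j Δ × (M , w ⊩ □ᶠ (ι Δ)))
  ι⁻ φs Δs p with ++⁻ φs (⋁⁻ (φs ++ boxes Δs) p)
  ... | inj₁ a = inj₁ a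
  ... | inj₂ b = inj₂ (boxes⁻ Δs b)

  IsMultiworld-child : ∀ {φs Δs j Δ} {I : Label → W M} → Nth Δs j Δ →
                       IsMultiworld M (φs ▸ Δs) I → IsMultiworld M Δ (λ σ → I (j ∷ σ))
  IsMultiworld-child n mw σ k σ∈Δ σk∈Δ = mw (_ ∷ σ) k (lchild n σ∈Δ) (lchild n σk∈Δ)

  IsMultiworld-graft : ∀ {φs Δs w} {f : ℕ → Label → W M} →
                       (∀ {j Δ} → Nth Δs j Δ → R M w (f j []) × IsMultiworld M Δ (f j)) →
                       IsMultiworld M (φs ▸ Δs) (graft w f)
  IsMultiworld-graft children []      k _                  (lchild n lroot) with children n
  ... | wRf , _ = wRf
  IsMultiworld-graft children (j ∷ σ) k (lchild m σ∈Δ) (lchild n σk∈Δ)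
    with Nth-functional m n
  ... | refl with children m
  ...   | _ , mw = mw σ k σ∈Δ σk∈Δ

  ⊨ᴵ-child : ∀ {φs Δs j Δ} {I : Label → W M} → Nth Δs j Δ →
             M , (λ σ → I (j ∷ σ)) ⊨ᴵ Δ → M , I ⊨ᴵ (φs ▸ Δs)
  ⊨ᴵ-child n (σ , φ , σ∶φ , p) = _ ∷ σ , φ , nthere n σ∶φ , p

  ¬⊨ᴵ-graft : ∀ {φs Δs w} {f : ℕ → Label → W M} →
              (∀ {φ} → φ ∈ φs → ¬ M , w ⊩ φ) →
              (∀ {j Δ} → Nth Δs j Δ → ¬ M , f j ⊨ᴵ Δ) →
              ¬ M , graft w f ⊨ᴵ (φs ▸ Δs)
  ¬⊨ᴵ-graft root children ([]    , φ , nhere φ∈φs  , p) = root φ∈φs p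
  ¬⊨ᴵ-graft root children (j ∷ σ , φ , nthere n σ∶φ , p) = children n (σ , φ , σ∶φ , p)

  ι⇒⊨ᴵ : ∀ Γ (I : Label → W M) → IsMultiworld M Γ I → M , I [] ⊩ ι Γ → M , I ⊨ᴵ Γ
  ι⇒⊨ᴵ = NSeq-ind _ step
    where
    step : ∀ φs Δs →
           (∀ {j Δ} → Nth Δs j Δ → ∀ I → IsMultiworld M Δ I → M , I [] ⊩ ι Δ → M , I ⊨ᴵ Δ) →
           ∀ I → IsMultiworld M (φs ▸ Δs) I → M , I [] ⊩ ι (φs ▸ Δs) → M , I ⊨ᴵ (φs ▸ Δs)
    step φs Δs ih I mw p with ι⁻ φs Δs p
    ... | inj₁ a with find a
    ...   | φ , φ∈φs , q = [] , φ , nhere φ∈φs , q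
    step φs Δs ih I mw p | inj₂ (j , Δ , n , □p) =
      ⊨ᴵ-child n (ih n _ (IsMultiworld-child n mw) (□p _ (mw [] j lroot (lchild n lroot))))

  Countermodel : NSeq → W M → Set
  Countermodel Γ w = Σ (Label → W M) λ I → I [] ≡ w × IsMultiworld M Γ I × ¬ M , I ⊨ᴵ Γ

  module _ (em : ExcludedMiddle 0ℓ) where

    ¬□⇒◇¬ : ∀ {w} ψ → ¬ M , w ⊩ □ᶠ ψ → Σ (W M) λ v → R M w v × ¬ M , v ⊩ ψ
    ¬□⇒◇¬ ψ ¬□ = dne λ ¬◇ → ¬□ λ v wRv → dne λ ¬ψ → ¬◇ (v , wRv , ¬ψ)
      where dne = em⇒dne em

    countermodel : ∀ Γ w → ¬ M , w ⊩ ι Γ → Countermodel Γ w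
    countermodel = NSeq-ind _ step
      where
      step : ∀ φs Δs → (∀ {j Δ} → Nth Δs j Δ → ∀ w → ¬ M , w ⊩ ι Δ → Countermodel Δ w) →
             ∀ w → ¬ M , w ⊩ ι (φs ▸ Δs) → Countermodel (φs ▸ Δs) w
      step φs Δs ih w ¬ι with Nth-choice (λ _ → w) Δs child
        where
        child : ∀ {j Δ} → Nth Δs j Δ →
                Σ (Label → W M) λ I → R M w (I []) × IsMultiworld M Δ I × ¬ M , I ⊨ᴵ Δ
        child {Δ = Δ} n with ¬□⇒◇¬ (ι Δ) (λ □p → ¬ι (ι-box⁺ φs n □p))
        ... | v , wRv , ¬ιv with ih n v ¬ιv
        ...   | I , refl , mw , ¬⊨ = I , wRv , mw , ¬⊨
      ... | f , children =
        graft w f , refl ,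
        IsMultiworld-graft (λ n → let wRf , mw , _ = children n in wRf , mw) ,
        ¬⊨ᴵ-graft (λ φ∈φs p → ¬ι (ι-formula⁺ Δs φ∈φs p))
                  (λ n → let _ , _ , ¬⊨ = children n in ¬⊨)

lemma1 : ExcludedMiddle 0ℓ → (Γ : NSeq) (M : Model) → (M ⊨ˢ Γ) ⇔ (M ⊨ᶠ ι Γ)
lemma1 em Γ M = mk⇔ complete sound
  where
  complete : M ⊨ˢ Γ → M ⊨ᶠ ι Γ
  complete ⊨Γ w = em⇒dne em λ ¬ι →
    let I , _ , mw , ¬⊨ = countermodel M em Γ w ¬ι in ¬⊨ (⊨Γ I mw)

  sound : M ⊨ᶠ ι Γ → M ⊨ˢ Γ
  sound ⊨ι I mw = ι⇒⊨ᴵ M Γ I mw (⊨ι (I []))
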